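{- For all integers $m,n\geq 0$, $$J^m_{n+1}=(m+1)\sum_{s=0}^{n}\binom{n}{s}J^{m+1}_s .$$
   Context: Let $X_n=\{1,\dots,n\}$. A preferential arrangement of $X_n$ is an ordered set partition: a linearly ordered sequence of pairwise disjoint nonempty subsets (blocks) whose union is $X_n$. A barred preferential arrangement of $X_n$ with $m$ bars is a preferential arrangement of $X_n$ together with $m$ indistinguishable bars inserted into the sequence of blocks (before the first block, between blocks, or after the last block, several bars possibly in the same place). Equivalently, it is a sequence of $m+1$ sections $S_1,\dots,S_{m+1}$, where the $S_i$ are pairwise disjoint, possibly empty, subsets with union $X_n$, and each $S_i$ carries a preferential arrangement of its elements. $J^m_n$ denotes the number of barred preferential arrangements of $X_n$ with $m$ bars; $J^0_n$ is the number of preferential arrangements of $X_n$, and $J^m_0=1$. -}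

module Defs where

open import Data.Nat using (ℕ; zero; suc)
open import Data.Fin using (Fin)
open import Data.Fin.Properties as FinP using ()
open import Data.Vec using (Vec; []; _∷_; toList)
open import Data.Vec.Membership.Propositional using (_∈_)
import Data.Vec.Membership.DecPropositional as DecMem
open import Data.List using (List; []; _∷_; [_]; map; concatMap; filter; length; allFin; upTo)
open import Data.List.Relation.Unary.Linked using (Linked; linked?)

open import Data.Product using (Σ; _×_; _,_)
open import Relation.Nullary using (Dec)

-- All maps X_n → Fin k, encoded as vectors (element i of X_n ↦ its entry).
allMaps : (k n : ℕ) → List (Vec (Fin k) n)
allMaps k zero = [ [] ]
allMaps k (suc n) = concatMap (λ v → map (_∷ v) (allFin k)) (allMaps k n)

Surjective : ∀ {k n} → Vec (Fin k) n → Set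
Surjective {k} v = (j : Fin k) → j ∈ v

surjective? : ∀ {k n} (v : Vec (Fin k) n) → Dec (Surjective v)
surjective? {k} v = FinP.all? (λ j → DecMem._∈?_ FinP._≟_ j v)

-- A preferential arrangement (ordered set partition) of X_n into k blocks:
-- a surjection X_n → Fin k, block j being the j-th block in the order.
prefArrs : (k n : ℕ) → List (Vec (Fin k) n)
prefArrs k n = filter surjective? (allMaps k n)

-- Placement of m indistinguishable bars into the k+1 gaps
-- (gap i = just before block i; gap k = after the last block):
-- a weakly increasing sequence of m gap indices (i.e. a multiset of gaps).
allBars : (k m : ℕ) → List (Vec (Fin (suc k)) m)
allBars k m = filter (λ b → linked? FinP._≤?_ (toList b)) (allMaps (suc k) m)

-- Barred preferential arrangement of X_n with m bars:
-- number of blocks k, a preferential arrangement with k blocks, and a bar placement.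
BPA : (m n : ℕ) → Set
BPA m n = Σ ℕ λ k → Vec (Fin k) n × Vec (Fin (suc k)) m

-- Complete list of barred preferential arrangements (k ranges over 0..n,
-- as a preferential arrangement of X_n has at most n blocks).
barredPrefArrs : (m n : ℕ) → List (BPA m n)
barredPrefArrs m n =
  concatMap (λ k → concatMap (λ p → map (λ b → (k , p , b)) (allBars k m)) (prefArrs k n))
            (upTo (suc n))

J : (m n : ℕ) → ℕ
J m n = length (barredPrefArrs m n)

-- A barred preferential arrangement of X_n with k blocks is a surjection X_n → Fin k together
-- with an m-multiset of the k + 1 gaps, so J^m_n = Σ_k c(n,k) M(k+1,m), where c(n,k) =
-- covering k 0 n counts surjections and M(r,m) = multichoose r m counts m-multisets of an r-set.
-- Sorting the maps X_n → Fin (k+1) that hit the first k points by the preimage of the last one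
-- gives Σ_s C(n,s) c(s,k) = covering k 1 n, and choosing the image of the element n + 1 first
-- gives c(n+1,k+1) = (k+1) covering k 1 n.  With the absorption identity
-- (m+1) M(k+1,m+1) = (k+1) M(k+2,m) this turns (m+1) Σ_s C(n,s) J^{m+1}_s into
-- Σ_k c(n+1,k+1) M(k+2,m) = J^m_{n+1}.
module Submission where

open import Defs
open import Data.Bool using (true; false; if_then_else_)
open import Data.Empty using (⊥-elim)
open import Data.Fin using (Fin; zero; suc; toℕ; _≟_)
open import Data.Fin.Properties using (toℕ<n; all?; _≤?_)
open import Data.Fin.Subset using (Subset; inside; outside; _∈_; _∉_; _-_; ⁅_⁆; ∣_∣; ∁; ⊤; ⊥)
open import Data.Fin.Subset.Properties
  using ( _∈?_; drop-there; ∈⊤; p─q⊆p; p─⊥≡p; x∈p∧x≢y⇒x∈p-y; x∈p⇒∣p-x∣<∣p∣; Empty-unique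
        ; ∣⊥∣≡0; ∣⊤∣≡n; ∣∁p∣≡n∸∣p∣)
open import Data.List
  using (List; []; _∷_; _++_; map; concatMap; filter; length; tabulate; allFin; applyUpTo; upTo)
open import Data.List.Properties using (map-++; map-cong; map-∘; length-++; length-map)
open import Data.List.Relation.Unary.Linked using (linked?)
open import Data.Nat using (ℕ; zero; suc; pred; _+_; _*_; _∸_; _≤_; _<_; z≤n; s≤s; s≤s⁻¹)
open import Data.Nat.Combinatorics using (_C_; nCk+nC[k+1]≡[n+1]C[k+1]; k>n⇒nCk≡0)
open import Data.Nat.ListAction using (sum)
open import Data.Nat.ListAction.Properties using (sum-++)
open import Data.Nat.Properties
  using ( +-*-semiring; +-commutativeSemigroup; *-commutativeSemigroup; +-assoc; +-comm; +-suc
        ; +-identityʳ; *-assoc; *-identityʳ; *-zeroʳ; *-distribˡ-+; *-distribʳ-+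
        ; n≤1+n; m<n⇒m<1+n; n≮0; 0≢1+n; n∸n≡0)
open import Data.Product using (_,_)
open import Data.Vec using (Vec; []; _∷_; toList; here; there)
import Data.Vec.Membership.DecPropositional as VecMembership
open import Data.Vec.Membership.Propositional using () renaming (_∈_ to _∈ᵥ_)
import Data.Vec.Relation.Unary.Any as Any
open import Function using (_∘_; id; _⇔_; mk⇔)
open import Relation.Binary.PropositionalEquality hiding (J)
open import Relation.Nullary using (Dec; does; yes; no; ¬_; _→-dec_)
open import Relation.Nullary.Decidable using (does-⇔; dec-true; dec-false)
open import Relation.Unary using (Pred; Decidable)
open import Algebra.Properties.Semiring.Sum +-*-semiring
  using (sum-syntax; sum-cong-≗; sum-replicate-zero; ∑-distrib-+; ∑-comm; *-distribˡ-sum; *-distribʳ-sum)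

open import Algebra.Properties.CommutativeSemigroup +-commutativeSemigroup
  using () renaming (x∙yz≈y∙xz to x+[y+z]≡y+[x+z])
open import Algebra.Properties.CommutativeSemigroup *-commutativeSemigroup
  using () renaming (x∙yz≈y∙xz to x*[y*z]≡y*[x*z])

private
  variable
    A B : Set
    k n : ℕ

-- The binomial transform

∑-vanishing : ∀ {N M} (f : ℕ → ℕ) → N ≤ M → (∀ i → N ≤ i → f i ≡ 0) →
  ∑[ i < M ] f (toℕ i) ≡ ∑[ i < N ] f (toℕ i)
∑-vanishing {M = M} f z≤n f≡0 =
  trans (sum-cong-≗ {M} {λ i → f (toℕ i)} {λ _ → 0} (λ i → f≡0 (toℕ i) z≤n)) (sum-replicate-zero M)
∑-vanishing f (s≤s N≤M) f≡0 =
  cong (f 0 +_) (∑-vanishing (λ i → f (suc i)) N≤M (λ i N≤i → f≡0 (suc i) (s≤s N≤i)))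

binomialTransform : (ℕ → ℕ) → ℕ → ℕ
binomialTransform g n = ∑[ i < suc n ] ((n C toℕ i) * g (toℕ i))

binomialTransform-suc : ∀ (g : ℕ → ℕ) n →
  binomialTransform g (suc n) ≡ binomialTransform g n + binomialTransform (g ∘ suc) n
binomialTransform-suc g n = begin
  g₀ + ∑[ i < suc n ] ((suc n C suc (toℕ i)) * g (suc (toℕ i)))
    ≡⟨ cong (g₀ +_) (trans (sum-cong-≗ pascal) (∑-distrib-+ shifted unshifted)) ⟩
  g₀ + (∑[ i < suc n ] shifted i + ∑[ i < suc n ] unshifted i)
    ≡⟨ cong (λ s → g₀ + (s + ∑[ i < suc n ] unshifted i))
            (∑-vanishing (λ i → (n C suc i) * g (suc i)) (n≤1+n n) shifted≡0) ⟩
  g₀ + (∑[ i < n ] ((n C suc (toℕ i)) * g (suc (toℕ i))) + ∑[ i < suc n ] unshifted i)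
    ≡⟨ sym (+-assoc g₀ _ _) ⟩
  binomialTransform g n + binomialTransform (g ∘ suc) n ∎
  where
  open ≡-Reasoning
  g₀ = 1 * g 0
  shifted unshifted : Fin (suc n) → ℕ
  shifted   i = (n C suc (toℕ i)) * g (suc (toℕ i))
  unshifted i = (n C toℕ i) * g (suc (toℕ i))
  pascal : ∀ i → (suc n C suc (toℕ i)) * g (suc (toℕ i)) ≡ shifted i + unshifted i
  pascal i = begin
    (suc n C suc (toℕ i)) * g (suc (toℕ i))
      ≡⟨ cong (_* g (suc (toℕ i))) (sym (nCk+nC[k+1]≡[n+1]C[k+1] n (toℕ i))) ⟩
    ((n C toℕ i) + (n C suc (toℕ i))) * g (suc (toℕ i))
      ≡⟨ *-distribʳ-+ (g (suc (toℕ i))) (n C toℕ i) _ ⟩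
    unshifted i + shifted i
      ≡⟨ +-comm (unshifted i) (shifted i) ⟩
    shifted i + unshifted i ∎
  shifted≡0 : ∀ i → n ≤ i → (n C suc i) * g (suc i) ≡ 0
  shifted≡0 i n≤i rewrite k>n⇒nCk≡0 (s≤s n≤i) = refl

binomialTransform-cong : ∀ {f g : ℕ → ℕ} n → (∀ s → s < suc n → f s ≡ g s) →
  binomialTransform f n ≡ binomialTransform g n
binomialTransform-cong n f≡g =
  sum-cong-≗ {suc n} (λ i → cong ((n C toℕ i) *_) (f≡g (toℕ i) (toℕ<n i)))

binomialTransform-+ : ∀ (f g : ℕ → ℕ) n →
  binomialTransform (λ i → f i + g i) n ≡ binomialTransform f n + binomialTransform g n
binomialTransform-+ f g n =
  trans (sum-cong-≗ {suc n} (λ i → *-distribˡ-+ (n C toℕ i) (f (toℕ i)) (g (toℕ i))))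
        (∑-distrib-+ {suc n} (λ i → (n C toℕ i) * f (toℕ i)) (λ i → (n C toℕ i) * g (toℕ i)))

binomialTransform-*ˡ : ∀ c (f : ℕ → ℕ) n →
  binomialTransform (λ i → c * f i) n ≡ c * binomialTransform f n
binomialTransform-*ˡ c f n =
  trans (sum-cong-≗ {suc n} (λ i → x*[y*z]≡y*[x*z] (n C toℕ i) c (f (toℕ i))))
        (sym (*-distribˡ-sum {suc n} c (λ i → (n C toℕ i) * f (toℕ i))))

binomialTransform-*ʳ : ∀ c (f : ℕ → ℕ) n →
  binomialTransform (λ i → f i * c) n ≡ binomialTransform f n * c
binomialTransform-*ʳ c f n =
  trans (sum-cong-≗ {suc n} (λ i → sym (*-assoc (n C toℕ i) (f (toℕ i)) c)))
        (sym (*-distribʳ-sum {suc n} c (λ i → (n C toℕ i) * f (toℕ i))))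

binomialTransform-∑ : ∀ {N} (F : Fin N → ℕ → ℕ) n →
  binomialTransform (λ i → ∑[ k < N ] F k i) n ≡ ∑[ k < N ] binomialTransform (F k) n
binomialTransform-∑ {N} F n =
  trans (sum-cong-≗ {suc n} (λ i → *-distribˡ-sum {N} (n C toℕ i) (λ k → F k (toℕ i))))
        (∑-comm {suc n} {N} (λ i k → (n C toℕ i) * F k (toℕ i)))

-- Covering numbers and multisets

-- covering s t n is the number of maps from an n-set to an (s + t)-set whose image contains
-- s designated points, counted by the image of the first element.  When s = 0 the second
-- summand is multiplied by 0, so the junk value pred 0 = 0 is harmless.
covering : ℕ → ℕ → ℕ → ℕ
covering s       t (suc n) = t * covering s t n + s * covering (pred s) (suc t) n
covering zero    t zero    = 1
covering (suc s) t zero    = 0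

covering-vanishes : ∀ {s n} t → n < s → covering s t n ≡ 0
covering-vanishes {suc s} {zero}  t _ = refl
covering-vanishes {suc s} {suc n} t (s≤s n<s)
  rewrite covering-vanishes t (m<n⇒m<1+n n<s) | covering-vanishes (suc t) n<s =
  cong₂ _+_ (*-zeroʳ t) (*-zeroʳ (suc s))

binomialTransform-covering : ∀ s t n → binomialTransform (covering s t) n ≡ covering s (suc t) n
binomialTransform-covering zero    t zero    = refl
binomialTransform-covering (suc s) t zero    = refl
binomialTransform-covering s       t (suc n) = begin
  binomialTransform (covering s t) (suc n)
    ≡⟨ binomialTransform-suc (covering s t) n ⟩
  binomialTransform (covering s t) n + binomialTransform (λ i → t * covering s t i + s * covering s′ (suc t) i) n
    ≡⟨ cong₂ _+_ (binomialTransform-covering s t n)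
                 (binomialTransform-+ (λ i → t * covering s t i) (λ i → s * covering s′ (suc t) i) n) ⟩
  covering s (suc t) n
    + (binomialTransform (λ i → t * covering s t i) n + binomialTransform (λ i → s * covering s′ (suc t) i) n)
    ≡⟨ cong (covering s (suc t) n +_)
            (cong₂ _+_ (scaled t (covering s t) (binomialTransform-covering s t n))
                       (scaled s (covering s′ (suc t)) (binomialTransform-covering s′ (suc t) n))) ⟩
  covering s (suc t) n + (t * covering s (suc t) n + s * covering s′ (suc (suc t)) n)
    ≡⟨ sym (+-assoc (covering s (suc t) n) _ _) ⟩
  covering s (suc t) (suc n) ∎
  where
  open ≡-Reasoning
  s′ = pred s
  scaled : ∀ c f {r} → binomialTransform f n ≡ r → binomialTransform (λ i → c * f i) n ≡ c * r
  scaled c f eq = trans (binomialTransform-*ˡ c f n) (cong (c *_) eq)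

-- multichoose r m counts weakly increasing m-sequences in an r-element chain by their first term.
multichoose : ℕ → ℕ → ℕ
multichoose r zero    = 1
multichoose r (suc m) = ∑[ x < r ] multichoose (r ∸ toℕ x) m

multichoose-1 : ∀ r → multichoose r 1 ≡ r
multichoose-1 zero    = refl
multichoose-1 (suc r) = cong suc (multichoose-1 r)

-- Pascal's rule multichoose (suc r) (suc m) = multichoose (suc r) m + multichoose r (suc m)
-- holds by definition; it is the first step of the inductive case.
multichoose-absorb : ∀ r m → r * multichoose (suc r) m ≡ suc m * multichoose r (suc m)
multichoose-absorb zero    m    = sym (*-zeroʳ (suc m))
multichoose-absorb (suc r) zero =
  trans (*-identityʳ (suc r)) (sym (trans (+-identityʳ _) (multichoose-1 (suc r))))
multichoose-absorb (suc r) (suc m) = begin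
  suc r * (multichoose (suc (suc r)) m + X)
    ≡⟨ *-distribˡ-+ (suc r) (multichoose (suc (suc r)) m) X ⟩
  suc r * multichoose (suc (suc r)) m + suc r * X
    ≡⟨ cong (_+ suc r * X) (multichoose-absorb (suc r) m) ⟩
  suc m * X + suc r * X
    ≡⟨ sym (*-distribʳ-+ X (suc m) (suc r)) ⟩
  (suc m + suc r) * X
    ≡⟨ cong (_* X) (+-suc (suc m) r) ⟩
  (suc (suc m) + r) * X
    ≡⟨ *-distribʳ-+ X (suc (suc m)) r ⟩
  suc (suc m) * X + r * X
    ≡⟨ cong (suc (suc m) * X +_) (multichoose-absorb r (suc m)) ⟩
  suc (suc m) * X + suc (suc m) * multichoose r (suc (suc m))
    ≡⟨ sym (*-distribˡ-+ (suc (suc m)) X _) ⟩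
  suc (suc m) * (X + multichoose r (suc (suc m))) ∎
  where
  open ≡-Reasoning
  X = multichoose (suc r) (suc m)

𝟙 : ∀ {p} {P : Set p} → Dec P → ℕ
𝟙 P? = if does P? then 1 else 0

𝟙-⇔ : ∀ {p q} {P : Set p} {Q : Set q} → P ⇔ Q → (P? : Dec P) (Q? : Dec Q) → 𝟙 P? ≡ 𝟙 Q?
𝟙-⇔ P⇔Q P? Q? = cong (λ b → if b then 1 else 0) (does-⇔ P⇔Q P? Q?)

𝟙-yes : ∀ {p} {P : Set p} (P? : Dec P) → P → 𝟙 P? ≡ 1
𝟙-yes P? p = cong (λ b → if b then 1 else 0) (dec-true P? p)

𝟙-no : ∀ {p} {P : Set p} (P? : Dec P) → ¬ P → 𝟙 P? ≡ 0
𝟙-no P? ¬p = cong (λ b → if b then 1 else 0) (dec-false P? ¬p)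

length-filter : ∀ {p} {P : Pred A p} (P? : Decidable P) xs →
  length (filter P? xs) ≡ sum (map (𝟙 ∘ P?) xs)
length-filter P? []       = refl
length-filter P? (x ∷ xs) with does (P? x)
... | true  = cong suc (length-filter P? xs)
... | false = length-filter P? xs

length-concatMap : ∀ (F : A → List B) xs → length (concatMap F xs) ≡ sum (map (length ∘ F) xs)
length-concatMap F []       = refl
length-concatMap F (x ∷ xs) = trans (length-++ (F x)) (cong (length (F x) +_) (length-concatMap F xs))

sum-map-const : ∀ c (xs : List A) → sum (map (λ _ → c) xs) ≡ length xs * c
sum-map-const c []       = refl
sum-map-const c (x ∷ xs) = cong (c +_) (sum-map-const c xs)

sum-map-++ : ∀ (g : A → ℕ) xs ys → sum (map g (xs ++ ys)) ≡ sum (map g xs) + sum (map g ys)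
sum-map-++ g xs ys = trans (cong sum (map-++ g xs ys)) (sum-++ (map g xs) (map g ys))

sum-map-concatMap : ∀ (g : B → ℕ) (F : A → List B) xs →
  sum (map g (concatMap F xs)) ≡ sum (map (λ x → sum (map g (F x))) xs)
sum-map-concatMap g F []       = refl
sum-map-concatMap g F (x ∷ xs) =
  trans (sum-map-++ g (F x) (concatMap F xs)) (cong (sum (map g (F x)) +_) (sum-map-concatMap g F xs))

sum-map-tabulate : ∀ (g : A → ℕ) (f : Fin k → A) → sum (map g (tabulate f)) ≡ ∑[ x < k ] g (f x)
sum-map-tabulate {k = zero}  g f = refl
sum-map-tabulate {k = suc k} g f = cong (g (f zero) +_) (sum-map-tabulate g (f ∘ suc))

sum-map-applyUpTo : ∀ (g f : ℕ → ℕ) N → sum (map g (applyUpTo f N)) ≡ ∑[ i < N ] g (f (toℕ i))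
sum-map-applyUpTo g f zero    = refl
sum-map-applyUpTo g f (suc N) = cong (g (f 0) +_) (sum-map-applyUpTo g (f ∘ suc) N)

sum-map-upTo : ∀ (g : ℕ → ℕ) N → sum (map g (upTo N)) ≡ ∑[ i < N ] g (toℕ i)
sum-map-upTo g = sum-map-applyUpTo g id

sum-map-∑ : ∀ (h : A → Fin k → ℕ) xs →
  sum (map (λ v → ∑[ x < k ] h v x) xs) ≡ ∑[ x < k ] sum (map (λ v → h v x) xs)
sum-map-∑ {k = k} h []       = sym (sum-replicate-zero k)
sum-map-∑         h (v ∷ xs) =
  trans (cong (∑[ x < _ ] h v x +_) (sum-map-∑ h xs)) (sym (∑-distrib-+ (h v) _))

sum-allMaps-suc : ∀ (g : Vec (Fin k) (suc n) → ℕ) →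
  sum (map g (allMaps k (suc n))) ≡ ∑[ x < k ] sum (map (λ v → g (x ∷ v)) (allMaps k n))
sum-allMaps-suc {k} {n} g = begin
  sum (map g (allMaps k (suc n)))
    ≡⟨ sum-map-concatMap g (λ v → map (_∷ v) (allFin k)) (allMaps k n) ⟩
  sum (map (λ v → sum (map g (map (_∷ v) (allFin k)))) (allMaps k n))
    ≡⟨ cong sum (map-cong (λ v → trans (cong sum (sym (map-∘ (allFin k))))
                                       (sum-map-tabulate (g ∘ (_∷ v)) id))
                          (allMaps k n)) ⟩
  sum (map (λ v → ∑[ x < k ] g (x ∷ v)) (allMaps k n))
    ≡⟨ sum-map-∑ (λ v x → g (x ∷ v)) (allMaps k n) ⟩
  ∑[ x < k ] sum (map (λ v → g (x ∷ v)) (allMaps k n)) ∎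
  where open ≡-Reasoning

countMaps : ∀ {p} {P : Pred (Vec (Fin k) n) p} → Decidable P → ℕ
countMaps {k} {n} P? = sum (map (𝟙 ∘ P?) (allMaps k n))

countMaps-∷ : ∀ {p} {P : Pred (Vec (Fin k) (suc n)) p} (P? : Decidable P) →
  countMaps P? ≡ ∑[ x < k ] countMaps (λ v → P? (x ∷ v))
countMaps-∷ P? = sum-allMaps-suc (𝟙 ∘ P?)

countMaps-cong : ∀ {p q} {P : Pred (Vec (Fin k) n) p} {Q : Pred (Vec (Fin k) n) q}
  (P? : Decidable P) (Q? : Decidable Q) → (∀ v → P v ⇔ Q v) → countMaps P? ≡ countMaps Q?
countMaps-cong {k} {n} P? Q? P⇔Q = cong sum (map-cong (λ v → 𝟙-⇔ (P⇔Q v) (P? v) (Q? v)) (allMaps k n))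

Covers : Subset k → Vec (Fin k) n → Set
Covers S v = ∀ j → j ∈ S → j ∈ᵥ v

covers? : (S : Subset k) → Decidable (Covers {n = n} S)
covers? S v = all? (λ j → j ∈? S →-dec VecMembership._∈?_ _≟_ j v)

x∉p-x : ∀ (x : Fin k) (p : Subset k) → x ∉ p - x
x∉p-x zero    (_ ∷ p) ()
x∉p-x (suc x) (_ ∷ p) = x∉p-x x p ∘ drop-there

Covers-∷ : ∀ (S : Subset k) x (v : Vec (Fin k) n) → Covers S (x ∷ v) ⇔ Covers (S - x) v
Covers-∷ S x v = mk⇔ to from
  where
  to : Covers S (x ∷ v) → Covers (S - x) v
  to cover j j∈S-x with cover j (p─q⊆p S ⁅ x ⁆ j∈S-x)
  ... | Any.here refl = ⊥-elim (x∉p-x x S j∈S-x)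
  ... | Any.there j∈v = j∈v
  from : Covers (S - x) v → Covers S (x ∷ v)
  from cover j j∈S with j ≟ x
  ... | yes j≡x = Any.here j≡x
  ... | no  j≢x = Any.there (cover j (x∈p∧x≢y⇒x∈p-y j∈S j≢x))

suc∣p-x∣≡∣p∣ : ∀ {x : Fin k} {p : Subset k} → x ∈ p → suc ∣ p - x ∣ ≡ ∣ p ∣
suc∣p-x∣≡∣p∣ {x = zero}  {inside  ∷ p} _   = cong (suc ∘ ∣_∣) (p─⊥≡p p)
suc∣p-x∣≡∣p∣ {x = suc x} {inside  ∷ p} x∈p = cong suc (suc∣p-x∣≡∣p∣ (drop-there x∈p))
suc∣p-x∣≡∣p∣ {x = suc x} {outside ∷ p} x∈p = suc∣p-x∣≡∣p∣ (drop-there x∈p)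

∣∁[p-x]∣≡suc∣∁p∣ : ∀ {x : Fin k} {p : Subset k} → x ∈ p → ∣ ∁ (p - x) ∣ ≡ suc ∣ ∁ p ∣
∣∁[p-x]∣≡suc∣∁p∣ {x = zero}  {inside  ∷ p} _   = cong (suc ∘ ∣_∣ ∘ ∁) (p─⊥≡p p)
∣∁[p-x]∣≡suc∣∁p∣ {x = suc x} {inside  ∷ p} x∈p = ∣∁[p-x]∣≡suc∣∁p∣ (drop-there x∈p)
∣∁[p-x]∣≡suc∣∁p∣ {x = suc x} {outside ∷ p} x∈p = cong suc (∣∁[p-x]∣≡suc∣∁p∣ (drop-there x∈p))

x∉p⇒p-x≡p : ∀ {x : Fin k} {p : Subset k} → x ∉ p → p - x ≡ p
x∉p⇒p-x≡p {x = zero}  {inside  ∷ p} x∉p = ⊥-elim (x∉p here)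
x∉p⇒p-x≡p {x = zero}  {outside ∷ p} _   = cong (outside ∷_) (p─⊥≡p p)
x∉p⇒p-x≡p {x = suc x} {s       ∷ p} x∉p = cong (s ∷_) (x∉p⇒p-x≡p (x∉p ∘ there))

∑-partition : ∀ (p : Subset k) {a b} (f : Fin k → ℕ) →
  (∀ x → x ∈ p → f x ≡ a) → (∀ x → x ∉ p → f x ≡ b) → ∑[ x < k ] f x ≡ ∣ p ∣ * a + ∣ ∁ p ∣ * b
∑-partition []            f _  _  = refl
∑-partition (inside  ∷ p) {a} f fa fb =
  trans (cong₂ _+_ (fa zero here) (∑-partition p (f ∘ suc) (λ x → fa (suc x) ∘ there)
                                                         (λ x x∉p → fb (suc x) (x∉p ∘ drop-there))))
        (sym (+-assoc a _ _))
∑-partition (outside ∷ p) {a} {b} f fa fb =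
  trans (cong₂ _+_ (fb zero (λ ())) (∑-partition p (f ∘ suc) (λ x → fa (suc x) ∘ there)
                                                           (λ x x∉p → fb (suc x) (x∉p ∘ drop-there))))
        (x+[y+z]≡y+[x+z] b (∣ p ∣ * a) _)

covers?-[] : ∀ (S : Subset k) t → 𝟙 (covers? S []) ≡ covering (∣ S ∣) t 0
covers?-[] {k} S t with ∣ S ∣ in ∣S∣≡
... | zero  = 𝟙-yes (covers? S []) λ j j∈S →
  ⊥-elim (n≮0 (subst (∣ S - j ∣ <_) ∣S∣≡ (x∈p⇒∣p-x∣<∣p∣ j∈S)))
... | suc s = 𝟙-no (covers? S []) λ cover →
  0≢1+n (trans (sym (∣⊥∣≡0 k)) (trans (cong ∣_∣ (sym (S≡⊥ cover))) ∣S∣≡))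
  where
  ∉[] : ∀ {j : Fin k} → ¬ j ∈ᵥ []
  ∉[] ()
  S≡⊥ : Covers S [] → S ≡ ⊥
  S≡⊥ cover = Empty-unique (λ (j , j∈S) → ∉[] (cover j j∈S))

countMaps-Covers : ∀ n (S : Subset k) → countMaps (covers? {n = n} S) ≡ covering (∣ S ∣) (∣ ∁ S ∣) n
countMaps-Covers zero        S = trans (+-identityʳ _) (covers?-[] S (∣ ∁ S ∣))
countMaps-Covers {k} (suc n) S = begin
  countMaps (covers? {n = suc n} S)
    ≡⟨ countMaps-∷ (covers? {n = suc n} S) ⟩
  ∑[ x < k ] countMaps (λ (v : Vec (Fin k) n) → covers? S (x ∷ v))
    ≡⟨ sum-cong-≗ {k} afterFirst ⟩
  ∑[ x < k ] covering (∣ S - x ∣) (∣ ∁ (S - x) ∣) n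
    ≡⟨ ∑-partition S _ removed kept ⟩
  ∣ S ∣ * covering (pred ∣ S ∣) (suc ∣ ∁ S ∣) n + ∣ ∁ S ∣ * covering (∣ S ∣) (∣ ∁ S ∣) n
    ≡⟨ +-comm (∣ S ∣ * covering (pred ∣ S ∣) (suc ∣ ∁ S ∣) n) _ ⟩
  covering (∣ S ∣) (∣ ∁ S ∣) (suc n) ∎
  where
  open ≡-Reasoning
  afterFirst : ∀ x →
    countMaps (λ (v : Vec (Fin k) n) → covers? S (x ∷ v)) ≡ covering (∣ S - x ∣) (∣ ∁ (S - x) ∣) n
  afterFirst x = trans (countMaps-cong (λ v → covers? S (x ∷ v)) (covers? {n = n} (S - x)) (Covers-∷ S x))
                       (countMaps-Covers n (S - x))
  removed : ∀ x → x ∈ S →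
    covering (∣ S - x ∣) (∣ ∁ (S - x) ∣) n ≡ covering (pred ∣ S ∣) (suc ∣ ∁ S ∣) n
  removed x x∈S = cong₂ (λ s t → covering s t n) (cong pred (suc∣p-x∣≡∣p∣ x∈S)) (∣∁[p-x]∣≡suc∣∁p∣ x∈S)
  kept : ∀ x → x ∉ S → covering (∣ S - x ∣) (∣ ∁ (S - x) ∣) n ≡ covering (∣ S ∣) (∣ ∁ S ∣) n
  kept x x∉S = cong (λ q → covering (∣ q ∣) (∣ ∁ q ∣) n) (x∉p⇒p-x≡p x∉S)

length-prefArrs : ∀ k n → length (prefArrs k n) ≡ covering k 0 n
length-prefArrs k n = begin
  length (prefArrs k n)
    ≡⟨ length-filter surjective? (allMaps k n) ⟩
  countMaps (surjective? {k} {n})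
    ≡⟨ countMaps-cong surjective? (covers? {n = n} ⊤) surjective⇔covers⊤ ⟩
  countMaps (covers? {n = n} ⊤)
    ≡⟨ countMaps-Covers n (⊤ {k}) ⟩
  covering (∣ ⊤ {k} ∣) (∣ ∁ (⊤ {k}) ∣) n
    ≡⟨ cong₂ (λ s t → covering s t n) (∣⊤∣≡n k)
             (trans (∣∁p∣≡n∸∣p∣ (⊤ {k})) (trans (cong (k ∸_) (∣⊤∣≡n k)) (n∸n≡0 k))) ⟩
  covering k 0 n ∎
  where
  open ≡-Reasoning
  surjective⇔covers⊤ : ∀ (v : Vec (Fin k) n) → Surjective v ⇔ Covers ⊤ v
  surjective⇔covers⊤ v = mk⇔ (λ surj j _ → surj j) (λ cover j → cover j ∈⊤)

-- Weakly increasing bar placements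

∑-from : ∀ {K} (g : ℕ → ℕ) (a : Fin K) →
  ∑[ x < K ] (if does (a ≤? x) then g (K ∸ toℕ x) else 0) ≡ ∑[ y < K ∸ toℕ a ] g (K ∸ toℕ a ∸ toℕ y)
∑-from         g zero    = refl
∑-from {suc K} g (suc a) =
  trans (sum-cong-≗ {K} (λ x → cong (λ b → if b then g (K ∸ toℕ x) else 0)
                                    (does-⇔ (mk⇔ s≤s⁻¹ s≤s) (suc a ≤? suc x) (a ≤? x))))
        (∑-from g a)

countMaps-linked-∷ : ∀ {K m} (a x : Fin K) →
  countMaps (λ (w : Vec (Fin K) m) → linked? _≤?_ (a ∷ x ∷ toList w))
    ≡ (if does (a ≤? x) then countMaps (λ (w : Vec (Fin K) m) → linked? _≤?_ (x ∷ toList w)) else 0)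
countMaps-linked-∷ {K} {m} a x with does (a ≤? x)
... | true  = refl
... | false = trans (sum-map-const 0 (allMaps K m)) (*-zeroʳ (length (allMaps K m)))

countMaps-linked : ∀ {K} m (a : Fin K) →
  countMaps (λ (w : Vec (Fin K) m) → linked? _≤?_ (a ∷ toList w)) ≡ multichoose (K ∸ toℕ a) m
countMaps-linked         zero    a = refl
countMaps-linked {K} (suc m) a = begin
  countMaps (λ (w : Vec (Fin K) (suc m)) → linked? _≤?_ (a ∷ toList w))
    ≡⟨ countMaps-∷ (λ (w : Vec (Fin K) (suc m)) → linked? _≤?_ (a ∷ toList w)) ⟩
  ∑[ x < K ] countMaps (λ (w : Vec (Fin K) m) → linked? _≤?_ (a ∷ x ∷ toList w))
    ≡⟨ sum-cong-≗ {K} (λ x → trans (countMaps-linked-∷ {K} {m} a x)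
                                   (cong (λ c → if does (a ≤? x) then c else 0) (countMaps-linked m x))) ⟩
  ∑[ x < K ] (if does (a ≤? x) then multichoose (K ∸ toℕ x) m else 0)
    ≡⟨ ∑-from (λ r → multichoose r m) a ⟩
  multichoose (K ∸ toℕ a) (suc m) ∎
  where open ≡-Reasoning

length-allBars : ∀ k m → length (allBars k m) ≡ multichoose (suc k) m
length-allBars k zero    = refl
length-allBars k (suc m) =
  trans (length-filter _ (allMaps (suc k) (suc m)))
  (trans (countMaps-∷ (λ (b : Vec (Fin (suc k)) (suc m)) → linked? _≤?_ (toList b)))
         (sum-cong-≗ {suc k} (countMaps-linked m)))

J-formula : ∀ m n → J m n ≡ ∑[ k < suc n ] (covering (toℕ k) 0 n * multichoose (suc (toℕ k)) m)
J-formula m n = begin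
  J m n
    ≡⟨ length-concatMap withBlocks (upTo (suc n)) ⟩
  sum (map (length ∘ withBlocks) (upTo (suc n)))
    ≡⟨ cong sum (map-cong length-withBlocks (upTo (suc n))) ⟩
  sum (map (λ k → covering k 0 n * multichoose (suc k) m) (upTo (suc n)))
    ≡⟨ sum-map-upTo (λ k → covering k 0 n * multichoose (suc k) m) (suc n) ⟩
  ∑[ k < suc n ] (covering (toℕ k) 0 n * multichoose (suc (toℕ k)) m) ∎
  where
  open ≡-Reasoning
  withBlocks : ℕ → List (BPA m n)
  withBlocks k = concatMap (λ p → map (λ b → (k , p , b)) (allBars k m)) (prefArrs k n)
  length-withBlocks : ∀ k → length (withBlocks k) ≡ covering k 0 n * multichoose (suc k) m
  length-withBlocks k = begin
    length (withBlocks k)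
      ≡⟨ length-concatMap (λ p → map (λ b → (k , p , b)) (allBars k m)) (prefArrs k n) ⟩
    sum (map (λ p → length (map (λ b → (k , p , b)) (allBars k m))) (prefArrs k n))
      ≡⟨ cong sum (map-cong (λ p → length-map _ (allBars k m)) (prefArrs k n)) ⟩
    sum (map (λ _ → length (allBars k m)) (prefArrs k n))
      ≡⟨ sum-map-const (length (allBars k m)) (prefArrs k n) ⟩
    length (prefArrs k n) * length (allBars k m)
      ≡⟨ cong₂ _*_ (length-prefArrs k n) (length-allBars k m) ⟩
    covering k 0 n * multichoose (suc k) m ∎

J-as-sum : ∀ m {n N} → n < N → J m n ≡ ∑[ k < N ] (covering (toℕ k) 0 n * multichoose (suc (toℕ k)) m)
J-as-sum m {n} n<N = trans (J-formula m n) (sym (∑-vanishing (λ k → covering k 0 n * multichoose (suc k) m) n<N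
  (λ k n<k → cong (_* multichoose (suc k) m) (covering-vanishes 0 n<k))))

binomialTransform-J : ∀ m n →
  binomialTransform (J m) n ≡ ∑[ k < suc n ] (covering (toℕ k) 1 n * multichoose (suc (toℕ k)) m)
binomialTransform-J m n = begin
  binomialTransform (J m) n
    ≡⟨ binomialTransform-cong n (λ s → J-as-sum m) ⟩
  binomialTransform (λ s → ∑[ k < suc n ] (covering (toℕ k) 0 s * multichoose (suc (toℕ k)) m)) n
    ≡⟨ binomialTransform-∑ {suc n} (λ k s → covering (toℕ k) 0 s * multichoose (suc (toℕ k)) m) n ⟩
  ∑[ k < suc n ] binomialTransform (λ s → covering (toℕ k) 0 s * multichoose (suc (toℕ k)) m) n
    ≡⟨ sum-cong-≗ {suc n} (λ k → trans (binomialTransform-*ʳ _ (covering (toℕ k) 0) n)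
                                        (cong (_* multichoose (suc (toℕ k)) m)
                                              (binomialTransform-covering (toℕ k) 0 n))) ⟩
  ∑[ k < suc n ] (covering (toℕ k) 1 n * multichoose (suc (toℕ k)) m) ∎
  where open ≡-Reasoning

theorem1 : (m n : ℕ) →
    J m (suc n) ≡ suc m * sum (map (λ s → (n C s) * J (suc m) s) (upTo (suc n)))
theorem1 m n = begin
  J m (suc n)
    ≡⟨ J-formula m (suc n) ⟩
  ∑[ k < suc (suc n) ] (covering (toℕ k) 0 (suc n) * multichoose (suc (toℕ k)) m)
    ≡⟨⟩ -- the summand for k = 0 is covering 0 0 (suc n) * _, which is 0 by definition
  ∑[ k < suc n ] (covering (suc (toℕ k)) 0 (suc n) * multichoose (suc (suc (toℕ k))) m)
    ≡⟨ sum-cong-≗ {suc n} (λ k → term (toℕ k)) ⟩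
  ∑[ k < suc n ] (suc m * (covering (toℕ k) 1 n * multichoose (suc (toℕ k)) (suc m)))
    ≡⟨ sym (*-distribˡ-sum {suc n} (suc m) (λ k → covering (toℕ k) 1 n * multichoose (suc (toℕ k)) (suc m))) ⟩
  suc m * ∑[ k < suc n ] (covering (toℕ k) 1 n * multichoose (suc (toℕ k)) (suc m))
    ≡⟨ cong (suc m *_) (sym (binomialTransform-J (suc m) n)) ⟩
  suc m * binomialTransform (J (suc m)) n
    ≡⟨ cong (suc m *_) (sym (sum-map-upTo (λ s → (n C s) * J (suc m) s) (suc n))) ⟩
  suc m * sum (map (λ s → (n C s) * J (suc m) s) (upTo (suc n))) ∎
  where
  open ≡-Reasoning
  -- covering (suc k) 0 (suc n) unfolds to suc k * covering k 1 n.
  term : ∀ k → covering (suc k) 0 (suc n) * multichoose (suc (suc k)) m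
             ≡ suc m * (covering k 1 n * multichoose (suc k) (suc m))
  term k = begin
    (suc k * c) * multichoose (suc (suc k)) m  ≡⟨ *-assoc (suc k) c _ ⟩
    suc k * (c * multichoose (suc (suc k)) m)  ≡⟨ x*[y*z]≡y*[x*z] (suc k) c _ ⟩
    c * (suc k * multichoose (suc (suc k)) m)  ≡⟨ cong (c *_) (multichoose-absorb (suc k) m) ⟩
    c * (suc m * multichoose (suc k) (suc m))  ≡⟨ x*[y*z]≡y*[x*z] c (suc m) _ ⟩
    suc m * (c * multichoose (suc k) (suc m))  ∎
    where c = covering k 1 n
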